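{- Let $\mathbf{B}=\langle B,\vee,\wedge,\neg,0,1\rangle$ be an involutive bisemilattice, and let $P(\mathbf{B})=\{a\in B : a\vee\neg a=a\}$ be its set of positive elements. Suppose $\mathbf{B}\cong \mathcal{P}_{\l}(\mathbb{A})$ where $\mathbb{A}=\langle \mathbf{A}_i,p_{ii'},I\rangle$ is a semilattice direct system of Boolean algebras with index semilattice $\langle I,\vee\rangle$ (with induced order $\leq$). Then $P(\mathbf{B})$ is closed under $\wedge$ and $\vee$, and (1) $\langle P(\mathbf{B}),\wedge\rangle\cong\langle P(\mathbf{B}),\vee\rangle$; (2) $\langle P(\mathbf{B}),\vee\rangle\cong\langle I,\vee\rangle$ (i.e. the semilattice $\langle I,\leq\rangle$).
   Context: An involutive bisemilattice is an algebra $\langle B,\vee,\wedge,\neg,0,1\rangle$ of type $(2,2,1,0,0)$ satisfying: $x\vee x\approx x$; $x\vee y\approx y\vee x$; $x\vee(y\vee z)\approx(x\vee y)\vee z$; $\neg\neg x\approx x$; $x\wedge y\approx\neg(\neg x\vee\neg y)$; $x\wedge(\neg x\vee y)\approx x\wedge y$; $0\vee x\approx x$; $1\approx\neg 0$. A semilattice direct system of Boolean algebras is a triple $\langle \mathbf{A}_i,p_{ii'},I\rangle$ where $I$ is a semilattice (ordered by $i\le j$ iff $i\vee j=j$, with a least element), $\{\mathbf{A}_i\}_{i\in I}$ are Boolean algebras with pairwise disjoint universes, and for $i\le i'$ the maps $p_{ii'}:\mathbf{A}_i\to\mathbf{A}_{i'}$ are Boolean homomorphisms with $p_{ii}$ the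 identity and $p_{i'i''}\circ p_{ii'}=p_{ii''}$ whenever $i\le i'\le i''$. Its Płonka sum $\mathcal{P}_{\l}(\mathbb{A})$ is the algebra on the disjoint union $\bigsqcup_{i\in I}A_i$ where, for an $n$-ary operation $g$ ($n\ge1$) and $a_r\in A_{i_r}$, with $j=i_1\vee\dots\vee i_n$, one sets $g(a_1,\dots,a_n)=g^{\mathbf{A}_j}(p_{i_1j}(a_1),\dots,p_{i_nj}(a_n))$, and constants are interpreted in the algebra at the least index. Every involutive bisemilattice is isomorphic to the Płonka sum of some semilattice direct system of Boolean algebras. -}

module Defs where

open import Level using (0ℓ)
open import Data.Product using (Σ; _,_; proj₁; proj₂; _×_; ∃)
open import Relation.Binary.PropositionalEquality
  using (_≡_; refl; sym; trans; cong; cong₂)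
open import Algebra.Core using (Op₁; Op₂)
open import Algebra.Bundles.Raw using (RawMagma)
import Algebra.Lattice.Structures as LS
open import Algebra.Morphism.Structures using (module MagmaMorphisms)
open import Function.Definitions using (Bijective)

record InvolutiveBisemilattice : Set₁ where
  infixr 6 _∨_
  infixr 7 _∧_
  field
    Carrier : Set
    _∨_ _∧_ : Op₂ Carrier
    ¬_      : Op₁ Carrier
    𝟘 𝟙     : Carrier
    ∨-idem  : ∀ x → x ∨ x ≡ x
    ∨-comm  : ∀ x y → x ∨ y ≡ y ∨ x
    ∨-assoc : ∀ x y z → x ∨ (y ∨ z) ≡ (x ∨ y) ∨ z
    ¬-invol : ∀ x → ¬ (¬ x) ≡ x
    ∧-def   : ∀ x y → x ∧ y ≡ ¬ (¬ x ∨ ¬ y)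
    ∧-¬∨    : ∀ x y → x ∧ (¬ x ∨ y) ≡ x ∧ y
    𝟘-∨     : ∀ x → 𝟘 ∨ x ≡ x
    𝟙-def   : 𝟙 ≡ ¬ 𝟘

-- Pairwise disjointness
-- of universes is automatic by taking the disjoint union Σ I A.
-- The maps p i j are indexed by i ≤ j (an irrelevant proof), so they
-- depend only on the pair (i , j).

record SemilatticeDirectSystem : Set₁ where
  field
    I        : Set
    _⊔_      : Op₂ I
    I-semilattice : LS.IsSemilattice {A = I} _≡_ _⊔_
    ⊥I       : I
    ⊥I-least : ∀ i → ⊥I ⊔ i ≡ i

  _≤_ : I → I → Set
  i ≤ j = i ⊔ j ≡ j

  field
    A       : I → Set
    ∨A ∧A   : ∀ i → Op₂ (A i)
    ¬A      : ∀ i → Op₁ (A i)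
    ⊤A ⊥A   : ∀ i → A i
    A-boolean : ∀ i → LS.IsBooleanAlgebra {A = A i} _≡_ (∨A i) (∧A i) (¬A i) (⊤A i) (⊥A i)
    p       : ∀ i j → .(i ≤ j) → A i → A j
    p-∨ : ∀ i j .(h : i ≤ j) a b → p i j h (∨A i a b) ≡ ∨A j (p i j h a) (p i j h b)
    p-∧ : ∀ i j .(h : i ≤ j) a b → p i j h (∧A i a b) ≡ ∧A j (p i j h a) (p i j h b)
    p-¬ : ∀ i j .(h : i ≤ j) a → p i j h (¬A i a) ≡ ¬A j (p i j h a)
    p-⊤ : ∀ i j .(h : i ≤ j) → p i j h (⊤A i) ≡ ⊤A j
    p-⊥ : ∀ i j .(h : i ≤ j) → p i j h (⊥A i) ≡ ⊥A j
    p-id   : ∀ i .(h : i ≤ i) a → p i i h a ≡ a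
    p-comp : ∀ i j k .(h₁ : i ≤ j) .(h₂ : j ≤ k) .(h₃ : i ≤ k) a →
             p j k h₂ (p i j h₁ a) ≡ p i k h₃ a

  open LS.IsSemilattice {A = I} _≡_ I-semilattice using (idem; assoc; comm)

  ≤-refl : ∀ i → i ≤ i
  ≤-refl i = idem i

  ≤-⊔ˡ : ∀ i j → i ≤ (i ⊔ j)
  ≤-⊔ˡ i j = trans (sym (assoc i i j)) (cong (_⊔ j) (idem i))

  ≤-⊔ʳ : ∀ i j → j ≤ (i ⊔ j)
  ≤-⊔ʳ i j = trans (cong (j ⊔_) (comm i j)) (trans (≤-⊔ˡ j i) (comm j i))

  PCarrier : Set
  PCarrier = Σ I A

  P∨ : Op₂ PCarrier
  P∨ (i , a) (j , b) = i ⊔ j , ∨A (i ⊔ j) (p i (i ⊔ j) (≤-⊔ˡ i j) a) (p j (i ⊔ j) (≤-⊔ʳ i j) b)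

  P∧ : Op₂ PCarrier
  P∧ (i , a) (j , b) = i ⊔ j , ∧A (i ⊔ j) (p i (i ⊔ j) (≤-⊔ˡ i j) a) (p j (i ⊔ j) (≤-⊔ʳ i j) b)

  P¬ : Op₁ PCarrier
  P¬ (i , a) = i , ¬A i (p i i (≤-refl i) a)

  P0 P1 : PCarrier
  P0 = ⊥I , ⊥A ⊥I
  P1 = ⊥I , ⊤A ⊥I

record IsoToPlonka (B : InvolutiveBisemilattice) (𝔸 : SemilatticeDirectSystem) : Set where
  open InvolutiveBisemilattice B
  open SemilatticeDirectSystem 𝔸
  field
    φ       : Carrier → PCarrier
    φ-bij   : Bijective _≡_ _≡_ φ
    φ-∨     : ∀ x y → φ (x ∨ y) ≡ P∨ (φ x) (φ y)
    φ-∧     : ∀ x y → φ (x ∧ y) ≡ P∧ (φ x) (φ y)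
    φ-¬     : ∀ x → φ (¬ x) ≡ P¬ (φ x)
    φ-𝟘     : φ 𝟘 ≡ P0
    φ-𝟙     : φ 𝟙 ≡ P1

module Positive (B : InvolutiveBisemilattice) where
  open InvolutiveBisemilattice B

  IsPositive : Carrier → Set
  IsPositive a = a ∨ ¬ a ≡ a

  Pos : Set
  Pos = Σ Carrier IsPositive

  _≈P_ : Pos → Pos → Set
  x ≈P y = proj₁ x ≡ proj₁ y

  ClosedUnder : Op₂ Carrier → Set
  ClosedUnder _·_ = ∀ a b → IsPositive a → IsPositive b → IsPositive (a · b)

  PosMagma : (_·_ : Op₂ Carrier) → ClosedUnder _·_ → RawMagma 0ℓ 0ℓ
  PosMagma _·_ cl = record
    { Carrier = Pos
    ; _≈_     = _≈P_
    ; _∙_     = λ x y → (proj₁ x · proj₁ y) , cl (proj₁ x) (proj₁ y) (proj₂ x) (proj₂ y)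
    }

IndexMagma : SemilatticeDirectSystem → RawMagma 0ℓ 0ℓ
IndexMagma 𝔸 = record
  { Carrier = SemilatticeDirectSystem.I 𝔸
  ; _≈_     = _≡_
  ; _∙_     = SemilatticeDirectSystem._⊔_ 𝔸
  }

_≅_ : RawMagma 0ℓ 0ℓ → RawMagma 0ℓ 0ℓ → Set
M₁ ≅ M₂ = ∃ λ f → MagmaMorphisms.IsMagmaIsomorphism M₁ M₂ f

-- In a Płonka sum of Boolean algebras an element is positive exactly when
-- it is the top of its fibre: within the fibre A i, a ∨ ¬ a = a forces
-- a = ⊤, and ⊤ ∨ b = ⊤ for anything b pushed into a larger fibre.  The
-- fibre tops are closed under both ∨ and ∧, and on them both operations
-- compute the top of the joined index.  Hence ∧ and ∨ coincide on P(B),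
-- and sending a positive element to its index is a semilattice
-- isomorphism onto I.
module Submission where

open import Level using (0ℓ)
open import Defs
open import Data.Product using (Σ; _×_; _,_; proj₁; proj₂)
open import Data.Product.Properties using (Σ-≡,≡←≡)
open import Relation.Binary.PropositionalEquality
open import Algebra.Lattice.Bundles using (BooleanAlgebra)
import Algebra.Lattice.Structures as LS
import Algebra.Lattice.Properties.BooleanAlgebra as BooleanAlgebraProperties

module PlonkaSum (𝔸 : SemilatticeDirectSystem) where
  open SemilatticeDirectSystem 𝔸
  open LS.IsSemilattice _≡_ I-semilattice using (idem)

  private
    booleanAlgebra : I → BooleanAlgebra 0ℓ 0ℓ
    booleanAlgebra i = record { isBooleanAlgebra = A-boolean i }

    module 𝔹 i = BooleanAlgebraProperties (booleanAlgebra i)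

  top : I → PCarrier
  top i = i , ⊤A i

  IsPositiveP : PCarrier → Set
  IsPositiveP x = P∨ x (P¬ x) ≡ x

  P∨-topˡ : ∀ i x → P∨ (top i) x ≡ top (i ⊔ proj₁ x)
  P∨-topˡ i (j , b) = cong (i ⊔ j ,_) (trans
    (cong (λ t → ∨A (i ⊔ j) t (p j (i ⊔ j) (≤-⊔ʳ i j) b)) (p-⊤ i (i ⊔ j) (≤-⊔ˡ i j)))
    (𝔹.∨-zeroˡ (i ⊔ j) _))

  P∨-top : ∀ i j → P∨ (top i) (top j) ≡ top (i ⊔ j)
  P∨-top i j = P∨-topˡ i (top j)

  P∧-top : ∀ i j → P∧ (top i) (top j) ≡ top (i ⊔ j)
  P∧-top i j = cong (i ⊔ j ,_) (trans
    (cong₂ (∧A (i ⊔ j)) (p-⊤ i (i ⊔ j) (≤-⊔ˡ i j)) (p-⊤ j (i ⊔ j) (≤-⊔ʳ i j)))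
    (𝔹.∧-idem (i ⊔ j) _))

  top-positive : ∀ i → IsPositiveP (top i)
  top-positive i = trans (P∨-topˡ i _) (cong top (idem i))

  -- The index k is kept general so that the equation of indices k ≡ i
  -- can be matched with refl.
  ∨¬-fixed⇒top : ∀ {i k} .(h : i ≤ k) a →
    _≡_ {A = PCarrier} (k , ∨A k (p i k h a) (p i k h (¬A i a))) (i , a) → a ≡ ⊤A i
  ∨¬-fixed⇒top {i} h a eq with Σ-≡,≡←≡ eq
  ... | refl , q = begin
    a                                    ≡⟨ sym q ⟩
    ∨A i (p i i h a) (p i i h (¬A i a))  ≡⟨ cong₂ (∨A i) (p-id i h a) (p-id i h (¬A i a)) ⟩
    ∨A i a (¬A i a)                      ≡⟨ BooleanAlgebra.∨-complementʳ (booleanAlgebra i) a ⟩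
    ⊤A i                                 ∎
    where open ≡-Reasoning

  positive⇒top : ∀ x → IsPositiveP x → x ≡ top (proj₁ x)
  positive⇒top (i , a) pos = cong (i ,_) (∨¬-fixed⇒top (≤-⊔ˡ i i) a
    (trans (cong (λ t → P∨ (i , a) (i , ¬A i t)) (sym (p-id i (≤-refl i) a))) pos))

module PositiveElements (B : InvolutiveBisemilattice) (𝔸 : SemilatticeDirectSystem)
                        (iso : IsoToPlonka B 𝔸) where
  open InvolutiveBisemilattice B
  open Positive B
  open SemilatticeDirectSystem 𝔸
  open IsoToPlonka iso
  open PlonkaSum 𝔸

  φ-injective : ∀ {x y} → φ x ≡ φ y → x ≡ y
  φ-injective = proj₁ φ-bij

  index : Carrier → I
  index a = proj₁ (φ a)

  φ-∨¬ : ∀ a → φ (a ∨ ¬ a) ≡ P∨ (φ a) (P¬ (φ a))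
  φ-∨¬ a = trans (φ-∨ a (¬ a)) (cong (P∨ (φ a)) (φ-¬ a))

  positive⇒φ-top : ∀ {a} → IsPositive a → φ a ≡ top (index a)
  positive⇒φ-top {a} pos = positive⇒top (φ a) (trans (sym (φ-∨¬ a)) (cong φ pos))

  φ-top⇒positive : ∀ {a i} → φ a ≡ top i → IsPositive a
  φ-top⇒positive {a} {i} e = φ-injective (begin
    φ (a ∨ ¬ a)              ≡⟨ φ-∨¬ a ⟩
    P∨ (φ a) (P¬ (φ a))      ≡⟨ cong (λ x → P∨ x (P¬ x)) e ⟩
    P∨ (top i) (P¬ (top i))  ≡⟨ top-positive i ⟩
    top i                    ≡⟨ sym e ⟩
    φ a                      ∎)
    where open ≡-Reasoning

  φ-∨-positive : ∀ {a b} → IsPositive a → IsPositive b → φ (a ∨ b) ≡ top (index a ⊔ index b)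
  φ-∨-positive {a} {b} pa pb = begin
    φ (a ∨ b)                           ≡⟨ φ-∨ a b ⟩
    P∨ (φ a) (φ b)                      ≡⟨ cong₂ P∨ (positive⇒φ-top pa) (positive⇒φ-top pb) ⟩
    P∨ (top (index a)) (top (index b))  ≡⟨ P∨-top (index a) (index b) ⟩
    top (index a ⊔ index b)             ∎
    where open ≡-Reasoning

  φ-∧-positive : ∀ {a b} → IsPositive a → IsPositive b → φ (a ∧ b) ≡ top (index a ⊔ index b)
  φ-∧-positive {a} {b} pa pb = begin
    φ (a ∧ b)                           ≡⟨ φ-∧ a b ⟩
    P∧ (φ a) (φ b)                      ≡⟨ cong₂ P∧ (positive⇒φ-top pa) (positive⇒φ-top pb) ⟩
    P∧ (top (index a)) (top (index b))  ≡⟨ P∧-top (index a) (index b) ⟩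
    top (index a ⊔ index b)             ∎
    where open ≡-Reasoning

  ∨-closed : ClosedUnder _∨_
  ∨-closed a b pa pb = φ-top⇒positive (φ-∨-positive pa pb)

  ∧-closed : ClosedUnder _∧_
  ∧-closed a b pa pb = φ-top⇒positive (φ-∧-positive pa pb)

  ∧≡∨-positive : ∀ {a b} → IsPositive a → IsPositive b → a ∧ b ≡ a ∨ b
  ∧≡∨-positive pa pb = φ-injective (trans (φ-∧-positive pa pb) (sym (φ-∨-positive pa pb)))

  index-injective-positive : ∀ {a b} → IsPositive a → IsPositive b → index a ≡ index b → a ≡ b
  index-injective-positive pa pb e =
    φ-injective (trans (positive⇒φ-top pa) (trans (cong top e) (sym (positive⇒φ-top pb))))

  top-preimage : I → Carrier
  top-preimage i = proj₁ (proj₂ φ-bij (top i))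

  φ-top-preimage : ∀ i → φ (top-preimage i) ≡ top i
  φ-top-preimage i = proj₂ (proj₂ φ-bij (top i)) refl

  ∧≅∨ : PosMagma _∧_ ∧-closed ≅ PosMagma _∨_ ∨-closed
  ∧≅∨ = (λ x → x) , record
    { isMagmaMonomorphism = record
      { isMagmaHomomorphism = record
        { isRelHomomorphism = record { cong = λ e → e }
        ; homo = λ x y → ∧≡∨-positive (proj₂ x) (proj₂ y) }
      ; injective = λ e → e }
    ; surjective = λ y → y , λ e → e }

  ∨≅index : PosMagma _∨_ ∨-closed ≅ IndexMagma 𝔸
  ∨≅index = (λ x → index (proj₁ x)) , record
    { isMagmaMonomorphism = record
      { isMagmaHomomorphism = record
        { isRelHomomorphism = record { cong = cong index }
        ; homo = λ x y → cong proj₁ (φ-∨ (proj₁ x) (proj₁ y)) }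
      ; injective = λ {x} {y} → index-injective-positive (proj₂ x) (proj₂ y) }
    ; surjective = λ i → (top-preimage i , φ-top⇒positive (φ-top-preimage i))
                       , λ e → trans (cong index e) (cong proj₁ (φ-top-preimage i)) }

proposition1 : (B : InvolutiveBisemilattice) (𝔸 : SemilatticeDirectSystem) →
    IsoToPlonka B 𝔸 →
    let open InvolutiveBisemilattice B in
    let open Positive B in
    Σ (ClosedUnder _∧_) (λ cl∧ → Σ (ClosedUnder _∨_) (λ cl∨ →
    (PosMagma _∧_ cl∧ ≅ PosMagma _∨_ cl∨) × (PosMagma _∨_ cl∨ ≅ IndexMagma 𝔸)))
proposition1 B 𝔸 iso = ∧-closed , ∨-closed , ∧≅∨ , ∨≅index
  where open PositiveElements B 𝔸 iso
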